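{- Every 5-crown is $(2P_3,C_4,C_6,C_7,\text{3-pentagon})$-free. Moreover, every 5-crown is anticonnected and contains no universal and no simplicial vertices.
   Context: All graphs are finite, simple and nonnull. $G$ is $H$-free if no induced subgraph is isomorphic to $H$. $C_k$: cycle on $k$ vertices; $2P_3$: disjoint union of two 3-vertex paths. The 3-pentagon has vertices $a,b_1,b_2,b_3,c_1,c_2,c_3$, with $a$ adjacent to all $b_i$ and no $c_i$, the $b_i$ pairwise nonadjacent, the $c_i$ pairwise adjacent, and $b_ic_j$ an edge iff $i=j$. Anticonnected: complement is connected; universal vertex: adjacent to all other vertices; simplicial vertex: its neighbors are pairwise adjacent. A 5-ring is a graph $R$ whose vertex set is partitioned into nonempty sets $X_0,\dots,X_4$ (indices in $\mathbb{Z}_5$) such that each $X_i$ can be ordered $u^i_1,\dots,u^i_{|X_i|}$ with $X_i\subseteq N_R[u^i_{|X_i|}]\subseteq\dots\subseteq N_R[u^i_1]=X_{i-1}\cup X_i\cup X_{i+1}$ (closed neighborhoods). A 5-crown is a 5-ring with such a partition for which some $i^*\in\mathbb{Z}_5$ has $X_{i^*-1}$ complete to $X_{i^*-2}$ and $X_{i^*+1}$ complete to $X_{i^*+2}$ (sets are complete to each other if every vertex of one is adjacent to every vertex of the other). -}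

module Defs where

open import Data.Nat using (ℕ; zero; suc; _≤_; _≡ᵇ_)
open import Data.Fin using (Fin; zero; suc; toℕ)
open import Data.Bool using (Bool; true; false; _∧_; _∨_)
open import Data.Bool.Properties using (∨-comm)
open import Data.List using (List; []; _∷_)
open import Data.Product using (Σ; _×_; _,_; ∃-syntax)
open import Data.Sum using (_⊎_)
open import Relation.Binary.PropositionalEquality using (_≡_; _≢_; refl; cong₂)
open import Relation.Binary.Construct.Closure.ReflexiveTransitive using (Star)
open import Relation.Nullary using (¬_)
open import Function.Definitions using (Injective)

record Graph : Set where
  field
    n      : ℕ
    adj    : Fin n → Fin n → Bool
    sym    : ∀ u v → adj u v ≡ adj v u
    irrefl : ∀ v → adj v v ≡ false

open Graph public

Adj : (G : Graph) → Fin (n G) → Fin (n G) → Set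
Adj G u v = adj G u v ≡ true

InN[_] : (G : Graph) → Fin (n G) → Fin (n G) → Set
InN[ G ] v w = w ≡ v ⊎ Adj G v w

InducedEmbedding : (H G : Graph) → Set
InducedEmbedding H G =
  Σ (Fin (n H) → Fin (n G)) λ f →
    Injective _≡_ _≡_ f × (∀ i j → adj G (f i) (f j) ≡ adj H i j)

_-free : Graph → Graph → Set
(H -free) G = ¬ InducedEmbedding H G

edgeAdj : ∀ {k} → List (ℕ × ℕ) → Fin k → Fin k → Bool
edgeAdj [] i j = false
edgeAdj ((a , b) ∷ es) i j =
  (((a ≡ᵇ toℕ i) ∧ (b ≡ᵇ toℕ j)) ∨ ((a ≡ᵇ toℕ j) ∧ (b ≡ᵇ toℕ i))) ∨ edgeAdj es i j

edgeAdj-sym : ∀ {k} (es : List (ℕ × ℕ)) (i j : Fin k) →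
              edgeAdj es i j ≡ edgeAdj es j i
edgeAdj-sym [] i j = refl
edgeAdj-sym ((a , b) ∷ es) i j =
  cong₂ _∨_ (∨-comm ((a ≡ᵇ toℕ i) ∧ (b ≡ᵇ toℕ j)) ((a ≡ᵇ toℕ j) ∧ (b ≡ᵇ toℕ i)))
            (edgeAdj-sym es i j)

2P3 : Graph
2P3 = record { n = 6 ; adj = edgeAdj es ; sym = edgeAdj-sym es ; irrefl = irr }
  where
  es : List (ℕ × ℕ)
  es = (0 , 1) ∷ (1 , 2) ∷ (3 , 4) ∷ (4 , 5) ∷ []
  irr : ∀ v → edgeAdj es v v ≡ false
  irr zero = refl
  irr (suc zero) = refl
  irr (suc (suc zero)) = refl
  irr (suc (suc (suc zero))) = refl
  irr (suc (suc (suc (suc zero)))) = refl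
  irr (suc (suc (suc (suc (suc zero))))) = refl

C4 : Graph
C4 = record { n = 4 ; adj = edgeAdj es ; sym = edgeAdj-sym es ; irrefl = irr }
  where
  es : List (ℕ × ℕ)
  es = (0 , 1) ∷ (1 , 2) ∷ (2 , 3) ∷ (3 , 0) ∷ []
  irr : ∀ v → edgeAdj es v v ≡ false
  irr zero = refl
  irr (suc zero) = refl
  irr (suc (suc zero)) = refl
  irr (suc (suc (suc zero))) = refl

C6 : Graph
C6 = record { n = 6 ; adj = edgeAdj es ; sym = edgeAdj-sym es ; irrefl = irr }
  where
  es : List (ℕ × ℕ)
  es = (0 , 1) ∷ (1 , 2) ∷ (2 , 3) ∷ (3 , 4) ∷ (4 , 5) ∷ (5 , 0) ∷ []
  irr : ∀ v → edgeAdj es v v ≡ false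
  irr zero = refl
  irr (suc zero) = refl
  irr (suc (suc zero)) = refl
  irr (suc (suc (suc zero))) = refl
  irr (suc (suc (suc (suc zero)))) = refl
  irr (suc (suc (suc (suc (suc zero))))) = refl

C7 : Graph
C7 = record { n = 7 ; adj = edgeAdj es ; sym = edgeAdj-sym es ; irrefl = irr }
  where
  es : List (ℕ × ℕ)
  es = (0 , 1) ∷ (1 , 2) ∷ (2 , 3) ∷ (3 , 4) ∷ (4 , 5) ∷ (5 , 6) ∷ (6 , 0) ∷ []
  irr : ∀ v → edgeAdj es v v ≡ false
  irr zero = refl
  irr (suc zero) = refl
  irr (suc (suc zero)) = refl
  irr (suc (suc (suc zero))) = refl
  irr (suc (suc (suc (suc zero)))) = refl
  irr (suc (suc (suc (suc (suc zero))))) = refl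
  irr (suc (suc (suc (suc (suc (suc zero)))))) = refl

-- 3-pentagon: a = 0, b₁ b₂ b₃ = 1 2 3, c₁ c₂ c₃ = 4 5 6;
-- a ~ bᵢ, the cᵢ form a clique, bᵢ ~ cⱼ iff i = j.
3-pentagon : Graph
3-pentagon = record { n = 7 ; adj = edgeAdj es ; sym = edgeAdj-sym es ; irrefl = irr }
  where
  es : List (ℕ × ℕ)
  es = (0 , 1) ∷ (0 , 2) ∷ (0 , 3)
     ∷ (4 , 5) ∷ (4 , 6) ∷ (5 , 6)
     ∷ (1 , 4) ∷ (2 , 5) ∷ (3 , 6) ∷ []
  irr : ∀ v → edgeAdj es v v ≡ false
  irr zero = refl
  irr (suc zero) = refl
  irr (suc (suc zero)) = refl
  irr (suc (suc (suc zero))) = refl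
  irr (suc (suc (suc (suc zero)))) = refl
  irr (suc (suc (suc (suc (suc zero))))) = refl
  irr (suc (suc (suc (suc (suc (suc zero)))))) = refl

succ₅ : Fin 5 → Fin 5
succ₅ zero = suc zero
succ₅ (suc zero) = suc (suc zero)
succ₅ (suc (suc zero)) = suc (suc (suc zero))
succ₅ (suc (suc (suc zero))) = suc (suc (suc (suc zero)))
succ₅ (suc (suc (suc (suc zero)))) = zero

pred₅ : Fin 5 → Fin 5
pred₅ zero = suc (suc (suc (suc zero)))
pred₅ (suc zero) = zero
pred₅ (suc (suc zero)) = suc zero
pred₅ (suc (suc (suc zero))) = suc (suc zero)
pred₅ (suc (suc (suc (suc zero)))) = suc (suc (suc zero))

-- A 5-ring structure on G: a partition of V(G) into nonempty X₀,…,X₄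
-- (given by part : V → ℤ₅, X i = {v | part v ≡ i}), and for each i an
-- ordering u^i : Fin (size i) → V enumerating X i bijectively, such that
--   X i ⊆ N[u^i_last] ⊆ … ⊆ N[u^i_first] = X(i-1) ∪ X i ∪ X(i+1).

record FiveRing (G : Graph) : Set where
  field
    part      : Fin (n G) → Fin 5
    size      : Fin 5 → ℕ
    first     : ∀ i → Fin (size i)          -- hence X i is nonempty
    last      : ∀ i → Fin (size i)
    first-min : ∀ i (j : Fin (size i)) → toℕ (first i) ≤ toℕ j
    last-max  : ∀ i (j : Fin (size i)) → toℕ j ≤ toℕ (last i)
    u         : ∀ i → Fin (size i) → Fin (n G)
    u-inj     : ∀ i → Injective _≡_ _≡_ (u i)
    u-in      : ∀ i j → part (u i j) ≡ i
    u-onto    : ∀ v → ∃[ j ] u (part v) j ≡ v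
    nested    : ∀ i (j j′ : Fin (size i)) → toℕ j ≤ toℕ j′ →
                ∀ w → InN[ G ] (u i j′) w → InN[ G ] (u i j) w
    last-⊇    : ∀ i w → part w ≡ i → InN[ G ] (u i (last i)) w
    first-⊆   : ∀ i w → InN[ G ] (u i (first i)) w →
                part w ≡ pred₅ i ⊎ part w ≡ i ⊎ part w ≡ succ₅ i
    first-⊇   : ∀ i w → part w ≡ pred₅ i ⊎ part w ≡ i ⊎ part w ≡ succ₅ i →
                InN[ G ] (u i (first i)) w

open FiveRing public

CompleteTo : (G : Graph) → FiveRing G → Fin 5 → Fin 5 → Set
CompleteTo G R i j = ∀ v w → part R v ≡ i → part R w ≡ j → Adj G v w

Is5Ring : Graph → Set
Is5Ring G = FiveRing G

Is5Crown : Graph → Set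
Is5Crown G = Σ (FiveRing G) λ R → ∃[ i ]
  CompleteTo G R (pred₅ i) (pred₅ (pred₅ i)) × CompleteTo G R (succ₅ i) (succ₅ (succ₅ i))

CoAdj : (G : Graph) → Fin (n G) → Fin (n G) → Set
CoAdj G u v = u ≢ v × adj G u v ≡ false

Connected-complement : Graph → Set
Connected-complement G = ∀ u v → Star (CoAdj G) u v

Anticonnected : Graph → Set
Anticonnected = Connected-complement

Universal : (G : Graph) → Fin (n G) → Set
Universal G v = ∀ w → w ≢ v → Adj G v w

Simplicial : (G : Graph) → Fin (n G) → Set
Simplicial G v = ∀ w w′ → Adj G v w → Adj G v w′ → w ≢ w′ → Adj G w w′

-- Label each vertex of a 5-crown by its part in ℤ₅. Adjacent vertices have
-- labels at distance at most 1, vertices with equal labels have comparable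
-- closed neighbourhoods (the nesting along uⁱ₁, uⁱ₂, …), and the two crown
-- conditions force certain pairs to be adjacent. An induced copy of H transfers
-- such a labelling to H, and a finite backtracking search shows that none of
-- 2P₃, C₄, C₆, C₇ and the 3-pentagon admits one.
-- Vertices whose labels are at distance 2 are distinct and non-adjacent, and
-- this relation on ℤ₅ is a 5-cycle, so any two vertices are joined by a path
-- of length at most 2 in the complement. The same relation makes v
-- non-adjacent to uⁱ⁺²₁, and makes the two neighbours uⁱ⁻¹₁, uⁱ⁺¹₁ of v
-- non-adjacent to each other, where i is the part of v.

module Submission where

open import Defs
open import Data.Product using (_×_)
open import Relation.Nullary using (¬_)

open import Data.Bool using (Bool; true; false; T)
import Data.Bool.Properties as Bool
open import Data.Empty using (⊥-elim)
open import Data.Nat using (ℕ)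
open import Data.Fin using (Fin; toℕ)
open import Data.Fin.Properties using (_≟_; all?; any?)
open import Data.List using (List; []; _∷_; allFin)
open import Data.List.Relation.Unary.All as All using (All; []; _∷_)
open import Data.Nat.Properties using (≤-total)
open import Data.Product using (_,_; proj₁; ∃-syntax)
open import Data.Sum as Sum using (_⊎_; inj₁; inj₂)
open import Function using (_∘_)
open import Relation.Binary.Construct.Closure.ReflexiveTransitive using (ε; _◅_)
open import Relation.Binary.PropositionalEquality as ≡ using (_≡_; _≢_; refl)
open import Relation.Nullary.Decidable
  using (Dec; isYes; True; from-yes; toWitness; ¬?; T?; _×-dec_; _⊎-dec_; _→-dec_)

Near : Fin 5 → Fin 5 → Set
Near i j = j ≡ pred₅ i ⊎ j ≡ i ⊎ j ≡ succ₅ i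

Far : Fin 5 → Fin 5 → Set
Far i j = j ≡ succ₅ (succ₅ i) ⊎ j ≡ pred₅ (pred₅ i)

near? : ∀ i j → Dec (Near i j)
near? i j = j ≟ pred₅ i ⊎-dec j ≟ i ⊎-dec j ≟ succ₅ i

far? : ∀ i j → Dec (Far i j)
far? i j = j ≟ succ₅ (succ₅ i) ⊎-dec j ≟ pred₅ (pred₅ i)

far⇒¬near : ∀ i j → Far i j → ¬ Near i j
far⇒¬near = from-yes (all? λ i → all? λ j → far? i j →-dec ¬? (near? i j))

far-irrefl : ∀ i → ¬ Far i i
far-irrefl i f = far⇒¬near i i f (inj₂ (inj₁ refl))

far-path : ∀ i j → Far i j ⊎ ∃[ t ] Far i t × Far t j
far-path = from-yes (all? λ i → all? λ j →
  far? i j ⊎-dec any? λ t → far? i t ×-dec far? t j)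

pred-far-succ : ∀ i → Far (pred₅ i) (succ₅ i)
pred-far-succ = from-yes (all? λ i → far? (pred₅ i) (succ₅ i))

near-pred : ∀ i → Near (pred₅ i) i
near-pred = from-yes (all? λ i → near? (pred₅ i) i)

near-succ : ∀ i → Near (succ₅ i) i
near-succ = from-yes (all? λ i → near? (succ₅ i) i)

pred₅≢ : ∀ i → pred₅ i ≢ i
pred₅≢ = from-yes (all? λ i → ¬? (pred₅ i ≟ i))

succ₅≢ : ∀ i → succ₅ i ≢ i
succ₅≢ = from-yes (all? λ i → ¬? (succ₅ i ≟ i))

adj? : (G : Graph) (v w : Fin (n G)) → Dec (Adj G v w)
adj? G v w = adj G v w Bool.≟ true

Adj-sym : (G : Graph) {v w : Fin (n G)} → Adj G v w → Adj G w v
Adj-sym G {v} {w} vw = ≡.trans (Graph.sym G w v) vw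

adj⇒¬coAdj : (G : Graph) {v w : Fin (n G)} → Adj G v w → ¬ CoAdj G v w
adj⇒¬coAdj G vw (_ , v≁w) = Bool.not-¬ vw v≁w

N[_]_⊆_ : (G : Graph) → Fin (n G) → Fin (n G) → Set
N[ G ] v ⊆ w = ∀ x → InN[ G ] v x → InN[ G ] w x

N[_]_⊆?_ : (G : Graph) (v w : Fin (n G)) → Dec (N[ G ] v ⊆ w)
N[ G ] v ⊆? w = all? λ x → (x ≟ v ⊎-dec adj? G v x) →-dec (x ≟ w ⊎-dec adj? G w x)

module FiveRingProperties {G : Graph} (R : FiveRing G) where

  u₁ : Fin 5 → Fin (n G)
  u₁ i = u R i (first R i)

  part-u₁ : ∀ i → part R (u₁ i) ≡ i
  part-u₁ i = u-in R i (first R i)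

  u-onto-part : ∀ {i v} → part R v ≡ i → ∃[ j ] u R i j ≡ v
  u-onto-part refl = u-onto R _

  N-u₁-⊇ : ∀ {i v} → part R v ≡ i → N[ G ] v ⊆ u₁ i
  N-u₁-⊇ {i} v∈Xᵢ with u-onto-part v∈Xᵢ
  ... | j , refl = nested R i (first R i) j (first-min R i j)

  adj⇒near : ∀ {v w} → Adj G v w → Near (part R v) (part R w)
  adj⇒near {v} {w} vw = first-⊆ R (part R v) w (N-u₁-⊇ refl w (inj₂ vw))

  same-part⇒N-⊆-total : ∀ {i v w} → part R v ≡ i → part R w ≡ i →
                        N[ G ] v ⊆ w ⊎ N[ G ] w ⊆ v
  same-part⇒N-⊆-total {i} v∈Xᵢ w∈Xᵢ with u-onto-part v∈Xᵢ | u-onto-part w∈Xᵢ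
  ... | j , refl | j′ , refl with ≤-total (toℕ j) (toℕ j′)
  ... | inj₁ j≤j′ = inj₂ (nested R i j j′ j≤j′)
  ... | inj₂ j′≤j = inj₁ (nested R i j′ j j′≤j)

  far⇒coAdj : ∀ {i j v w} → Far i j → part R v ≡ i → part R w ≡ j → CoAdj G v w
  far⇒coAdj {i} {j} {v} {w} far refl refl = v≢w , non-adjacent
    where
    v≢w : v ≢ w
    v≢w refl = far-irrefl i far
    non-adjacent : adj G v w ≡ false
    non-adjacent = Bool.¬-not (far⇒¬near i j far ∘ adj⇒near)

  u₁-adj : ∀ i v → Near i (part R v) → part R v ≢ i → Adj G v (u₁ i)
  u₁-adj i v near v∉Xᵢ with first-⊇ R i v near
  ... | inj₁ refl = ⊥-elim (v∉Xᵢ (part-u₁ i))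
  ... | inj₂ adj  = Adj-sym G adj

  anticonnected : Anticonnected G
  anticonnected v w with far-path (part R v) (part R w)
  ... | inj₁ far = far⇒coAdj far refl refl ◅ ε
  ... | inj₂ (t , far₁ , far₂) =
    far⇒coAdj far₁ refl (part-u₁ t) ◅ far⇒coAdj far₂ (part-u₁ t) refl ◅ ε

  no-universal : ∀ v → ¬ Universal G v
  no-universal v universal = adj⇒¬coAdj G (universal w (proj₁ v-w ∘ ≡.sym)) v-w
    where
    w = u₁ (succ₅ (succ₅ (part R v)))
    v-w : CoAdj G v w
    v-w = far⇒coAdj (inj₁ refl) refl (part-u₁ _)

  no-simplicial : ∀ v → ¬ Simplicial G v
  no-simplicial v simplicial =
    adj⇒¬coAdj G (simplicial a b v-a v-b (proj₁ a-b)) a-b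
    where
    i = part R v
    a = u₁ (pred₅ i)
    b = u₁ (succ₅ i)
    v-a : Adj G v a
    v-a = u₁-adj (pred₅ i) v (near-pred i) (pred₅≢ i ∘ ≡.sym)
    v-b : Adj G v b
    v-b = u₁-adj (succ₅ i) v (near-succ i) (succ₅≢ i ∘ ≡.sym)
    a-b : CoAdj G a b
    a-b = far⇒coAdj (pred-far-succ i) (part-u₁ _) (part-u₁ _)

module InducedEmbeddingProperties {H G : Graph} (f : Fin (n H) → Fin (n G))
  (f-adj : ∀ x y → adj G (f x) (f y) ≡ adj H x y) where

  adj-reflect : ∀ {x y} → Adj G (f x) (f y) → Adj H x y
  adj-reflect {x} {y} = ≡.trans (≡.sym (f-adj x y))

  module _ (f-inj : ∀ {x y} → f x ≡ f y → x ≡ y) where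

    InN-preserve : ∀ {x z} → InN[ H ] x z → InN[ G ] (f x) (f z)
    InN-preserve (inj₁ refl) = inj₁ refl
    InN-preserve {x} {z} (inj₂ xz) = inj₂ (≡.trans (f-adj x z) xz)

    InN-reflect : ∀ {x z} → InN[ G ] (f x) (f z) → InN[ H ] x z
    InN-reflect (inj₁ fz≡fx) = inj₁ (f-inj fz≡fx)
    InN-reflect (inj₂ fxfz)  = inj₂ (adj-reflect fxfz)

    N-⊆-reflect : ∀ {x y} → N[ G ] f x ⊆ f y → N[ H ] x ⊆ y
    N-⊆-reflect sub z = InN-reflect ∘ sub (f z) ∘ InN-preserve

module LabellingSearch {k m : ℕ} (Ok : Fin k → Fin k → Fin m → Fin m → Set)
  (ok? : ∀ x y a b → Dec (Ok x y a b)) where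

  Valid : (Fin k → Fin m) → Set
  Valid p = ∀ x y → Ok x y (p x) (p y)

  Assignment : Set
  Assignment = List (Fin k × Fin m)

  Extends : (Fin k → Fin m) → Assignment → Set
  Extends p = All λ (y , b) → p y ≡ b

  Consistent : Fin k → Fin m → Assignment → Set
  Consistent x a = All λ (y , b) → Ok x y a b × Ok y x b a

  consistent? : ∀ x a σ → Dec (Consistent x a σ)
  consistent? x a = All.all? λ (y , b) → ok? x y a b ×-dec ok? y x b a

  refutes : List (Fin k) → Assignment → Bool
  every-label-refuted? : ∀ x xs σ →
                         Dec (∀ a → Consistent x a σ → T (refutes xs ((x , a) ∷ σ)))

  refutes []       σ = false
  refutes (x ∷ xs) σ = isYes (every-label-refuted? x xs σ)

  every-label-refuted? x xs σ =
    all? λ a → consistent? x a σ →-dec T? (refutes xs ((x , a) ∷ σ))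

  valid⇒consistent : ∀ {p} → Valid p → ∀ x {σ} → Extends p σ → Consistent x (p x) σ
  valid⇒consistent valid x []           = []
  valid⇒consistent valid x (refl ∷ ext) =
    (valid x _ , valid _ x) ∷ valid⇒consistent valid x ext

  refutes-sound : ∀ {p} → Valid p → ∀ xs {σ} → Extends p σ → ¬ T (refutes xs σ)
  refutes-sound valid []       ext ()
  refutes-sound {p} valid (x ∷ xs) {σ} ext r =
    refutes-sound valid xs (refl ∷ ext)
      (every-label-refuted (p x) (valid⇒consistent valid x ext))
    where
    every-label-refuted = toWitness {a? = every-label-refuted? x xs σ} r

  no-valid-labelling : T (refutes (allFin k) []) → ∀ p → ¬ Valid p
  no-valid-labelling r p valid = refutes-sound valid (allFin k) [] r

CrownCompatible : (H : Graph) → Fin 5 → Fin (n H) → Fin (n H) → Fin 5 → Fin 5 → Set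
CrownCompatible H s x y a b =
    (Adj H x y → Near a b)
  × (a ≡ b → N[ H ] x ⊆ y ⊎ N[ H ] y ⊆ x)
  × (a ≡ pred₅ s → b ≡ pred₅ (pred₅ s) → Adj H x y)
  × (a ≡ succ₅ s → b ≡ succ₅ (succ₅ s) → Adj H x y)

crownCompatible? : ∀ H s x y a b → Dec (CrownCompatible H s x y a b)
crownCompatible? H s x y a b =
      (adj? H x y →-dec near? a b)
  ×-dec (a ≟ b →-dec (N[ H ] x ⊆? y ⊎-dec N[ H ] y ⊆? x))
  ×-dec (a ≟ pred₅ s →-dec b ≟ pred₅ (pred₅ s) →-dec adj? H x y)
  ×-dec (a ≟ succ₅ s →-dec b ≟ succ₅ (succ₅ s) →-dec adj? H x y)

module CrownSearch (H : Graph) (s : Fin 5) =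
  LabellingSearch (CrownCompatible H s) (crownCompatible? H s)

embedding-crownCompatible :
  ∀ {H G : Graph} (R : FiveRing G) s →
  CompleteTo G R (pred₅ s) (pred₅ (pred₅ s)) →
  CompleteTo G R (succ₅ s) (succ₅ (succ₅ s)) →
  ((f , _ , _) : InducedEmbedding H G) → CrownSearch.Valid H s (part R ∘ f)
embedding-crownCompatible {H} {G} R s complete₁ complete₂ (f , f-inj , f-adj) x y =
    adj⇒near ∘ ≡.trans (f-adj x y)
  , (λ eq → Sum.map (N-⊆-reflect f-inj) (N-⊆-reflect f-inj)
                    (same-part⇒N-⊆-total eq refl))
  , (λ p q → adj-reflect (complete₁ (f x) (f y) p q))
  , (λ p q → adj-reflect (complete₂ (f x) (f y) p q))
  where
  open FiveRingProperties R
  open InducedEmbeddingProperties {H} {G} f f-adj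

crown-free : (H : Graph)
             {_ : True (all? λ s → T? (CrownSearch.refutes H s (allFin (n H)) []))} →
             ∀ G → Is5Crown G → (H -free) G
crown-free H {refuted} G (R , s , complete₁ , complete₂) e@(f , _) =
  CrownSearch.no-valid-labelling H s (toWitness refuted s) (part R ∘ f)
    (embedding-crownCompatible {H} R s complete₁ complete₂ e)

proposition6p7 : (G : Graph) → Is5Crown G →
    (2P3 -free) G × (C4 -free) G × (C6 -free) G × (C7 -free) G × (3-pentagon -free) G
    × Anticonnected G
    × (∀ v → ¬ Universal G v)
    × (∀ v → ¬ Simplicial G v)
proposition6p7 G crown@(R , _) =
    crown-free 2P3 G crown
  , crown-free C4 G crown
  , crown-free C6 G crown
  , crown-free C7 G crown
  , crown-free 3-pentagon G crown
  , anticonnected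
  , no-universal
  , no-simplicial
  where open FiveRingProperties R
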